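{- Let $G$ be a graph, let $S$ be a distinguishing set of $G$ and let $\emptyset\neq S'\subseteq S$. Let $F\subseteq E(G^S)$ be a set of edges consisting of exactly two edges with label $u$ for each $u\in S'$, and let $H$ be the subgraph of $G^S$ induced by $F$ (edge set $F$, vertex set the endpoints of edges in $F$). Then every connected component of $H$ is a cactus.
   Context: $N(x)$ is the open neighborhood of $x$ in $G$. A set $S$ of vertices is distinguishing if $N(x)\cap S\neq N(y)\cap S$ for all distinct $x,y\notin S$. The $S$-associated graph $G^S$ is the edge-labeled graph with vertex set $V(G)\setminus S$, where $x,y$ are adjacent iff $N(x)\cap S$ and $N(y)\cap S$ differ in exactly one vertex $u\in S$, and the edge $xy$ then has label $\ell(xy)=u$. A cactus is a connected graph all of whose blocks (maximal connected subgraphs without cut vertices) are cycles or edges; equivalently, a connected graph in which no edge lies on two cycles. -}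

module Defs where

open import Data.Nat using (ℕ; _≤_)
open import Data.Fin using (Fin)
open import Data.Bool using (Bool; true; false)
open import Data.List using (List; []; _∷_; _++_; take; length)
open import Data.List.Relation.Unary.All using (All)
open import Data.List.Relation.Unary.Unique.Propositional using (Unique)
open import Data.Product using (Σ; ∃; _×_; _,_)
open import Data.Sum using (_⊎_)
open import Relation.Nullary using (¬_)
open import Relation.Binary.PropositionalEquality using (_≡_; _≢_)
open import Function.Bundles using (_⇔_)

record Graph (n : ℕ) : Set where
  field
    adj    : Fin n → Fin n → Bool
    sym    : ∀ x y → adj x y ≡ adj y x
    irrefl : ∀ x → adj x x ≡ false
open Graph public

Subset : ℕ → Set
Subset n = Fin n → Bool

_⊆_ : ∀ {n} → Subset n → Subset n → Set
A ⊆ B = ∀ v → A v ≡ true → B v ≡ true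

SameTrace : ∀ {n} → Graph n → Subset n → Fin n → Fin n → Set
SameTrace G S x y = ∀ v → S v ≡ true → adj G x v ≡ adj G y v

Distinguishing : ∀ {n} → Graph n → Subset n → Set
Distinguishing G S = ∀ x y → S x ≡ false → S y ≡ false → x ≢ y → ¬ SameTrace G S x y

GSEdge : ∀ {n} → Graph n → Subset n → Fin n → Fin n → Fin n → Set
GSEdge G S x y u =
  S x ≡ false × S y ≡ false × S u ≡ true × adj G x u ≢ adj G y u ×
  (∀ v → S v ≡ true → v ≢ u → adj G x v ≡ adj G y v)

SameEdge : ∀ {n} → Fin n → Fin n → Fin n → Fin n → Set
SameEdge a b c d = (a ≡ c × b ≡ d) ⊎ (a ≡ d × b ≡ c)

data Reach {n : ℕ} (E : Fin n → Fin n → Set) : Fin n → Fin n → Set where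
  stay : ∀ {x} → Reach E x x
  step : ∀ {x y z} → E x y → Reach E y z → Reach E x z

data Consec {A : Set} : List A → A → A → Set where
  here  : ∀ {x y xs} → Consec (x ∷ y ∷ xs) x y
  there : ∀ {x xs a b} → Consec xs a b → Consec (x ∷ xs) a b

closed : ∀ {A : Set} → List A → List A
closed vs = vs ++ take 1 vs

CycEdge : ∀ {n} → List (Fin n) → Fin n → Fin n → Set
CycEdge vs a b = Consec (closed vs) a b ⊎ Consec (closed vs) b a

IsCycle : ∀ {n} → (Fin n → Set) → (Fin n → Fin n → Set) → List (Fin n) → Set
IsCycle V E vs =
  3 ≤ length vs × Unique vs × All V vs × (∀ a b → Consec (closed vs) a b → E a b)

-- Two cycles are the same subgraph iff they have the same edge set.
SameCycle : ∀ {n} → List (Fin n) → List (Fin n) → Set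
SameCycle c₁ c₂ = ∀ a b → CycEdge c₁ a b ⇔ CycEdge c₂ a b

Cactus : ∀ {n} → (Fin n → Set) → (Fin n → Fin n → Set) → Set
Cactus V E =
  (∀ x y → V x → V y → Reach E x y) ×
  (∀ c₁ c₂ → IsCycle V E c₁ → IsCycle V E c₂ →
     ∀ a b → CycEdge c₁ a b → CycEdge c₂ a b → SameCycle c₁ c₂)

VH : ∀ {n} → (Fin n → Fin n → Set) → Fin n → Set
VH F x = ∃ λ y → F x y

CompV : ∀ {n} → (Fin n → Fin n → Set) → Fin n → Fin n → Set
CompV F v₀ x = VH F x × Reach F v₀ x

CompE : ∀ {n} → (Fin n → Fin n → Set) → Fin n → Fin n → Fin n → Set
CompE F v₀ x y = F x y × Reach F v₀ x

-- Going once around a cycle of H, the adjacency to a fixed u ∈ S changes exactly at the edges labelled u,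
-- so a cycle meeting two vertices p, q that u separates carries a u-edge on each of its two p–q arcs.
-- If two cycles C₁ ≠ C₂ of H shared an edge, C₁ would contain an ear of C₂: a path between distinct
-- vertices p, q of C₂ using no edge of C₂. As S is distinguishing, some u ∈ S separates p and q; the ear
-- then carries a u-edge too, giving three u-edges in H, while F contains only two.
module Submission where

open import Defs
open import Data.Nat using (ℕ; zero; suc; _≤_; s≤s; s≤s⁻¹)
open import Data.Nat.Properties using (suc-injective)
open import Data.Fin using (Fin; _≟_)
open import Data.Fin.Properties using (¬∀⟶∃¬)
open import Data.Bool using (true; false)
import Data.Bool.Properties as Bool
open import Data.Product using (∃; ∃₂; _×_; _,_; proj₁; proj₂)
open import Data.Sum using (_⊎_; inj₁; inj₂)
open import Data.Empty using (⊥; ⊥-elim)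
open import Relation.Nullary using (¬_; Dec; yes; no)
open import Relation.Binary.PropositionalEquality
  using (_≡_; _≢_; refl; trans; subst; cong) renaming (sym to ≡-sym)
open import Data.List using (List; []; _∷_; _++_; _∷ʳ_; length)
open import Data.List.Properties using (length-++-comm)
open import Data.List.Membership.Propositional using (_∈_; _∉_)
open import Data.List.Membership.Propositional.Properties using (∈-++⁻)
import Data.List.Membership.DecPropositional as DecMembership
open import Data.List.Relation.Unary.Any using (here; there)
open import Data.List.Relation.Unary.AllPairs using (_∷_; [])
open import Data.List.Relation.Unary.All using ([])
open import Data.List.Relation.Unary.Unique.Propositional using (Unique)
open import Data.List.Relation.Unary.Unique.Propositional.Properties using (++⁺; Unique[x∷xs]⇒x∉xs)
open import Function.Bundles using (mk⇔)

data Ends {A : Set} : A → List A → A → Set where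
  end  : ∀ {x} → Ends x [] x
  next : ∀ {x y ws z} → Ends y ws z → Ends x (y ∷ ws) z

module _ {A : Set} where

  ends-∈ : ∀ {x z : A} {ws} → Ends x ws z → z ∈ x ∷ ws
  ends-∈ end      = here refl
  ends-∈ (next e) = there (ends-∈ e)

  ends-∷ʳ : ∀ (x : A) ws z → Ends x (ws ∷ʳ z) z
  ends-∷ʳ x []       z = next end
  ends-∷ʳ x (y ∷ ws) z = next (ends-∷ʳ y ws z)

  unique-rotate : ∀ {v : A} {vs} → Unique (v ∷ vs) → Unique (vs ∷ʳ v)
  unique-rotate u@(_ ∷ uniq) = ++⁺ uniq ([] ∷ []) λ { (v∈vs , here refl) → Unique[x∷xs]⇒x∉xs u v∈vs }

  closed-∈ : ∀ (vs : List A) {a} → a ∈ closed vs → a ∈ vs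
  closed-∈ (v ∷ vs) a∈ with ∈-++⁻ (v ∷ vs) a∈
  ... | inj₁ a∈vs        = a∈vs
  ... | inj₂ (here refl) = here refl

  consec-++⁺ˡ : ∀ {xs ys : List A} {a b} → Consec xs a b → Consec (xs ++ ys) a b
  consec-++⁺ˡ here      = here
  consec-++⁺ˡ (there c) = there (consec-++⁺ˡ c)

  position : ∀ {xs : List A} {a b} → Consec xs a b → ℕ
  position here      = zero
  position (there c) = suc (position c)

  position-++⁺ˡ : ∀ {xs ys : List A} {a b} (c : Consec xs a b) →
                  position (consec-++⁺ˡ {ys = ys} c) ≡ position c
  position-++⁺ˡ here      = refl
  position-++⁺ˡ (there c) = cong suc (position-++⁺ˡ c)

  consec-∈ : ∀ {xs : List A} {a b} → Consec xs a b → a ∈ xs × b ∈ xs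
  consec-∈ here      = here refl , there (here refl)
  consec-∈ (there c) = there (proj₁ (consec-∈ c)) , there (proj₂ (consec-∈ c))

  consec-∈-tail : ∀ {x : A} {xs a b} → Consec (x ∷ xs) a b → b ∈ xs
  consec-∈-tail here      = here refl
  consec-∈-tail (there c) = proj₂ (consec-∈ c)

  consec-∷ʳ : ∀ (xs : List A) v w → Consec ((xs ∷ʳ v) ∷ʳ w) v w
  consec-∷ʳ []       v w = here
  consec-∷ʳ (x ∷ xs) v w = there (consec-∷ʳ xs v w)

  consec-∷ʳ⁻ : ∀ (xs : List A) v w {a b} →
               Consec ((xs ∷ʳ v) ∷ʳ w) a b → Consec (xs ∷ʳ v) a b ⊎ (a ≡ v × b ≡ w)
  consec-∷ʳ⁻ []           v w here              = inj₂ (refl , refl)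
  consec-∷ʳ⁻ []           v w (there (there ()))
  consec-∷ʳ⁻ (x ∷ [])     v w here              = inj₁ here
  consec-∷ʳ⁻ (x ∷ y ∷ xs) v w here              = inj₁ here
  consec-∷ʳ⁻ (x ∷ xs)     v w (there c) with consec-∷ʳ⁻ xs v w c
  ... | inj₁ c′ = inj₁ (there c′)
  ... | inj₂ e  = inj₂ e

  closed-rotate⁺ : ∀ (v w : A) r {x y} → Consec (closed (v ∷ w ∷ r)) x y → Consec (closed (w ∷ r ∷ʳ v)) x y
  closed-rotate⁺ v w r here      = consec-∷ʳ (w ∷ r) v w
  closed-rotate⁺ v w r (there c) = consec-++⁺ˡ c

  closed-rotate⁻ : ∀ (v w : A) r {x y} → Consec (closed (w ∷ r ∷ʳ v)) x y → Consec (closed (v ∷ w ∷ r)) x y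
  closed-rotate⁻ v w r c with consec-∷ʳ⁻ (w ∷ r) v w c
  ... | inj₁ c′             = there c′
  ... | inj₂ (refl , refl) = here

  -- The cycle vs with its edge ab deleted, read as a path from b to a.
  record Opening (vs : List A) (a b : A) : Set where
    field
      path     : List A
      unique   : Unique (b ∷ path)
      ends     : Ends b path a
      sound    : ∀ {x y} → Consec (b ∷ path) x y → Consec (closed vs) x y
      complete : ∀ {x y} → Consec (closed vs) x y → Consec (b ∷ path) x y ⊎ (x ≡ a × y ≡ b)
      length≡  : length vs ≡ suc (length path)

  opening-rotate : ∀ {v w : A} {r a b} → Opening (w ∷ r ∷ʳ v) a b → Opening (v ∷ w ∷ r) a b
  opening-rotate {v} {w} {r} o = record
    { path     = path
    ; unique   = unique
    ; ends     = ends
    ; sound    = λ c → closed-rotate⁻ v w r (sound c)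
    ; complete = λ c → complete (closed-rotate⁺ v w r c)
    ; length≡  = trans (cong suc (≡-sym (length-++-comm r (v ∷ [])))) length≡
    }
    where open Opening o

  open-at : ∀ {vs : List A} {a b} → Unique vs → Consec (closed vs) a b → Opening vs a b
  open-at uniq c = go (position c) uniq c refl
    where
    go : ∀ k {vs : List A} {a b} → Unique vs → (c : Consec (closed vs) a b) → position c ≡ k → Opening vs a b
    go k {v ∷ []} uniq here _ = record
      { path = [] ; unique = uniq ; ends = end ; sound = λ { (there ()) }
      ; complete = λ { here → inj₂ (refl , refl) ; (there (there ())) } ; length≡ = refl }
    go k {v ∷ w ∷ r} uniq here _ = record
      { path = r ∷ʳ v ; unique = unique-rotate uniq ; ends = ends-∷ʳ w r v ; sound = there
      ; complete = λ { here → inj₂ (refl , refl) ; (there c) → inj₁ c }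
      ; length≡ = cong suc (≡-sym (length-++-comm r (v ∷ []))) }
    go (suc k) {v ∷ w ∷ r} uniq (there c) p≡k =
      opening-rotate (go k (unique-rotate uniq) (consec-++⁺ˡ c) (trans (position-++⁺ˡ c) (suc-injective p≡k)))
    go k {v ∷ []} uniq (there (there ())) _

module _ {n : ℕ} where

  EdgeRel : Set₁
  EdgeRel = Fin n → Fin n → Set

  _∖_ : EdgeRel → EdgeRel → EdgeRel
  (R ∖ E) a b = R a b × ¬ E a b

  reach-map : ∀ {E E′ : EdgeRel} → (∀ {a b} → E a b → E′ a b) → ∀ {x y} → Reach E x y → Reach E′ x y
  reach-map f stay       = stay
  reach-map f (step e r) = step (f e) (reach-map f r)

  reach-∷ʳ : ∀ {E : EdgeRel} {x y z} → Reach E x y → E y z → Reach E x z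
  reach-∷ʳ stay       e′ = step e′ stay
  reach-∷ʳ (step e r) e′ = step e (reach-∷ʳ r e′)

  reach-++ : ∀ {E : EdgeRel} {x y z} → Reach E x y → Reach E y z → Reach E x z
  reach-++ stay       r′ = r′
  reach-++ (step e r) r′ = step e (reach-++ r r′)

  reach-reverse : ∀ {E : EdgeRel} → (∀ {a b} → E a b → E b a) → ∀ {x y} → Reach E x y → Reach E y x
  reach-reverse E-sym stay       = stay
  reach-reverse E-sym (step e r) = reach-∷ʳ (reach-reverse E-sym r) (E-sym e)

  reach-along : ∀ {x z : Fin n} {ws} → z ∈ x ∷ ws → Reach (Consec (x ∷ ws)) x z
  reach-along (here refl)           = stay
  reach-along {ws = _ ∷ _} (there p) = step here (reach-map there (reach-along p))

  sameEdge-sym : ∀ {a b c d : Fin n} → SameEdge a b c d → SameEdge c d a b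
  sameEdge-sym (inj₁ (refl , refl)) = inj₁ (refl , refl)
  sameEdge-sym (inj₂ (refl , refl)) = inj₂ (refl , refl)

  sameEdge-trans : ∀ {a b c d e f : Fin n} → SameEdge a b c d → SameEdge c d e f → SameEdge a b e f
  sameEdge-trans (inj₁ (refl , refl)) q                    = q
  sameEdge-trans (inj₂ (refl , refl)) (inj₁ (refl , refl)) = inj₂ (refl , refl)
  sameEdge-trans (inj₂ (refl , refl)) (inj₂ (refl , refl)) = inj₁ (refl , refl)

  three-edges-among-two : ∀ {a b c d x₁ y₁ x₂ y₂ x₃ y₃ : Fin n} →
    ¬ SameEdge x₁ y₁ x₂ y₂ → ¬ SameEdge x₁ y₁ x₃ y₃ → ¬ SameEdge x₂ y₂ x₃ y₃ →
    SameEdge x₁ y₁ a b ⊎ SameEdge x₁ y₁ c d →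
    SameEdge x₂ y₂ a b ⊎ SameEdge x₂ y₂ c d →
    SameEdge x₃ y₃ a b ⊎ SameEdge x₃ y₃ c d → ⊥
  three-edges-among-two ≢₁₂ _ _ (inj₁ e₁) (inj₁ e₂) _ = ≢₁₂ (sameEdge-trans e₁ (sameEdge-sym e₂))
  three-edges-among-two ≢₁₂ _ _ (inj₂ e₁) (inj₂ e₂) _ = ≢₁₂ (sameEdge-trans e₁ (sameEdge-sym e₂))
  three-edges-among-two _ ≢₁₃ _ (inj₁ e₁) _ (inj₁ e₃) = ≢₁₃ (sameEdge-trans e₁ (sameEdge-sym e₃))
  three-edges-among-two _ ≢₁₃ _ (inj₂ e₁) _ (inj₂ e₃) = ≢₁₃ (sameEdge-trans e₁ (sameEdge-sym e₃))
  three-edges-among-two _ _ ≢₂₃ (inj₁ _) (inj₂ e₂) (inj₂ e₃) = ≢₂₃ (sameEdge-trans e₂ (sameEdge-sym e₃))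
  three-edges-among-two _ _ ≢₂₃ (inj₂ _) (inj₁ e₂) (inj₁ e₃) = ≢₂₃ (sameEdge-trans e₂ (sameEdge-sym e₃))

  path-edge-not-closing : ∀ {t s x y : Fin n} {ws} → Unique (t ∷ ws) → Ends t ws s → 2 ≤ length ws →
                          Consec (t ∷ ws) x y → ¬ SameEdge x y s t
  path-edge-not-closing uniq _ _ c (inj₁ (refl , refl)) = Unique[x∷xs]⇒x∉xs uniq (consec-∈-tail c)
  path-edge-not-closing uniq (next end) (s≤s ()) here (inj₂ (refl , refl))
  path-edge-not-closing (_ ∷ uniq) (next (next e)) _ here (inj₂ (refl , refl)) =
    Unique[x∷xs]⇒x∉xs uniq (ends-∈ e)
  path-edge-not-closing uniq _ _ (there c) (inj₂ (refl , refl)) = Unique[x∷xs]⇒x∉xs uniq (proj₁ (consec-∈ c))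

  consec? : ∀ (xs : List (Fin n)) a b → Dec (Consec xs a b)
  consec? []           a b = no λ ()
  consec? (x ∷ [])     a b = no λ { (there ()) }
  consec? (x ∷ y ∷ xs) a b with a ≟ x | b ≟ y | consec? (y ∷ xs) a b
  ... | yes refl | yes refl | _     = yes here
  ... | _        | _        | yes c = yes (there c)
  ... | no a≢x   | _        | no ¬c = no λ { here → a≢x refl ; (there c) → ¬c c }
  ... | yes _    | no b≢y   | no ¬c = no λ { here → b≢y refl ; (there c) → ¬c c }

  cycEdge? : ∀ (vs : List (Fin n)) a b → Dec (CycEdge vs a b)
  cycEdge? vs a b with consec? (closed vs) a b | consec? (closed vs) b a
  ... | yes c | _     = yes (inj₁ c)
  ... | no _  | yes c = yes (inj₂ c)
  ... | no ¬c | no ¬d = no λ { (inj₁ c) → ¬c c ; (inj₂ d) → ¬d d }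

  cycEdge-∈ : ∀ (vs : List (Fin n)) {a b} → CycEdge vs a b → a ∈ vs × b ∈ vs
  cycEdge-∈ vs (inj₁ c) = closed-∈ vs (proj₁ (consec-∈ c)) , closed-∈ vs (proj₂ (consec-∈ c))
  cycEdge-∈ vs (inj₂ c) = closed-∈ vs (proj₂ (consec-∈ c)) , closed-∈ vs (proj₁ (consec-∈ c))

  cycEdge-swap : ∀ (vs : List (Fin n)) {a b} → CycEdge vs a b → CycEdge vs b a
  cycEdge-swap vs (inj₁ c) = inj₂ c
  cycEdge-swap vs (inj₂ c) = inj₁ c

  cycEdge-resp : ∀ (vs : List (Fin n)) {a b c d} → SameEdge a b c d → CycEdge vs c d → CycEdge vs a b
  cycEdge-resp vs (inj₁ (refl , refl)) e = e
  cycEdge-resp vs (inj₂ (refl , refl)) e = cycEdge-swap vs e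

  isCycle-map : ∀ {V : Fin n → Set} {E E′ : EdgeRel} → (∀ {a b} → E a b → E′ a b) →
                ∀ {vs} → IsCycle V E vs → IsCycle V E′ vs
  isCycle-map f (len , uniq , inV , inE) = len , uniq , inV , λ a b c → f (inE a b c)

  Ear : (Fin n → Set) → EdgeRel → EdgeRel → Set
  Ear V R E = ∃₂ λ p q → V p × V q × p ≢ q × Reach (R ∖ E) p q

module _ {n : ℕ} (V : Fin n → Set) (V? : ∀ x → Dec (V x)) (R E : EdgeRel {n})
         (E? : ∀ a b → Dec (E a b)) (E⊆V : ∀ {a b} → E a b → V a × V b) where

  private
    walk-until-V : ∀ {p} y ws {z} → p ∉ y ∷ ws → V p → Reach (R ∖ E) p y → Ends y ws z → V z →
                   (∀ {a b} → Consec (y ∷ ws) a b → R a b) → Ear V R E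
    walk-until-V y ws p∉ Vp walk _ _ _ with V? y
    ... | yes Vy = _ , y , Vp , Vy , (λ p≡y → p∉ (here p≡y)) , walk
    walk-until-V y []        p∉ Vp walk end      Vz along | no ¬Vy = ⊥-elim (¬Vy Vz)
    walk-until-V y (y′ ∷ ws) p∉ Vp walk (next e) Vz along | no ¬Vy =
      walk-until-V y′ ws (λ p∈ → p∉ (there p∈)) Vp
                   (reach-∷ʳ walk (along here , λ Eyy′ → ¬Vy (proj₁ (E⊆V Eyy′))))
                   e Vz (λ c → along (there c))

  path-leaving-E-has-ear : ∀ x ws {z} → Unique (x ∷ ws) → Ends x ws z → V x → V z →
                           (∀ {a b} → Consec (x ∷ ws) a b → R a b) →
                           ∀ {s t} → Consec (x ∷ ws) s t → ¬ E s t → Ear V R E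
  path-leaving-E-has-ear x [] _ _ _ _ _ (there ()) _
  path-leaving-E-has-ear x (y ∷ ws) u@(_ ∷ uniq) (next e) Vx Vz along c ¬Est with E? x y | c
  ... | no ¬Exy | _        =
    walk-until-V y ws (Unique[x∷xs]⇒x∉xs u) Vx (step (along here , ¬Exy) stay) e Vz (λ c′ → along (there c′))
  ... | yes Exy | here     = ⊥-elim (¬Est Exy)
  ... | yes Exy | there c′ =
    path-leaving-E-has-ear y ws uniq e (proj₂ (E⊆V Exy)) Vz (λ c″ → along (there c″)) c′ ¬Est

module _ {n : ℕ} (G : Graph n) (S : Subset n) where

  Separates : Fin n → Fin n → Fin n → Set
  Separates u p q = S u ≡ true × adj G p u ≢ adj G q u

  InGS : EdgeRel {n} → Set
  InGS E = ∀ {a b} → E a b → ∃ (GSEdge G S a b)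

  gsEdge-label-unique : ∀ {x y u u′} → GSEdge G S x y u → GSEdge G S x y u′ → u ≡ u′
  gsEdge-label-unique {u = u} {u′} (_ , _ , Su , x≁y , _) (_ , _ , _ , _ , same) with u ≟ u′
  ... | yes u≡u′ = u≡u′
  ... | no u≢u′  = ⊥-elim (x≁y (same u Su u≢u′))

  gsEdge-separates : ∀ {x y u} → GSEdge G S x y u → Separates u y x
  gsEdge-separates (_ , _ , Su , x≁y , _) = Su , λ y~x → x≁y (≡-sym y~x)

  walk-crosses-label : ∀ {E} → InGS E → ∀ {u p q} → Reach E p q → Separates u p q →
                       ∃₂ λ a b → E a b × GSEdge G S a b u
  walk-crosses-label lab stay (_ , p≁p) = ⊥-elim (p≁p refl)
  walk-crosses-label lab {u} (step {x} {y} e r) (Su , x≁z) with lab e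
  ... | u′ , g@(_ , _ , _ , _ , same) with u ≟ u′
  ...   | yes refl = x , y , e , g
  ...   | no u≢u′  = walk-crosses-label lab r (Su , λ y~z → x≁z (trans (same u Su u≢u′) y~z))

  walk-ends-outside : ∀ {E} → InGS E → ∀ {p q} → Reach E p q → p ≡ q ⊎ (S p ≡ false × S q ≡ false)
  walk-ends-outside lab stay = inj₁ refl
  walk-ends-outside lab (step e r) with lab e | walk-ends-outside lab r
  ... | _ , (Sx , Sy , _) | inj₁ refl      = inj₂ (Sx , Sy)
  ... | _ , (Sx , _ , _)  | inj₂ (_ , Sz)  = inj₂ (Sx , Sz)

  distinguishing-separates : Distinguishing G S → ∀ {p q} → S p ≡ false → S q ≡ false → p ≢ q →
                             ∃ λ u → Separates u p q
  distinguishing-separates dist {p} {q} Sp Sq p≢q with ¬∀⟶∃¬ n Agrees agrees? (dist p q Sp Sq p≢q)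
    where
    Agrees : Fin n → Set
    Agrees v = S v ≡ true → adj G p v ≡ adj G q v
    agrees? : ∀ v → Dec (Agrees v)
    agrees? v with S v | adj G p v Bool.≟ adj G q v
    ... | false | _       = yes λ ()
    ... | true  | yes p~q = yes λ _ → p~q
    ... | true  | no p≁q  = no λ agree → p≁q (agree refl)
  ... | v , disagree with S v in Sv
  ...   | true  = v , Sv , λ p~q → disagree λ _ → p~q
  ...   | false = ⊥-elim (disagree λ ())

  cycle-has-second-labelled-edge :
    ∀ {vs s t u} → 3 ≤ length vs → InGS (Consec (closed vs)) → Opening vs s t → GSEdge G S s t u →
    ∃₂ λ s′ t′ → Consec (closed vs) s′ t′ × GSEdge G S s′ t′ u × ¬ SameEdge s′ t′ s t
  cycle-has-second-labelled-edge 3≤len lab o g =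
    let (s′ , t′ , c′ , g′) =
          walk-crosses-label (λ c → lab (sound c)) (reach-along (ends-∈ ends)) (gsEdge-separates g)
    in  s′ , t′ , sound c′ , g′ , path-edge-not-closing unique ends (s≤s⁻¹ (subst (3 ≤_) length≡ 3≤len)) c′
    where open Opening o

  -- u separates the first vertex v of the cycle from p or from q, so walking from v along the cycle
  -- meets a first u-edge.
  cycle-has-two-labelled-edges :
    ∀ {vs} → Unique vs → 3 ≤ length vs → InGS (Consec (closed vs)) →
    ∀ {u p q} → p ∈ vs → q ∈ vs → Separates u p q →
    ∃₂ λ s₁ t₁ → ∃₂ λ s₂ t₂ →
      Consec (closed vs) s₁ t₁ × GSEdge G S s₁ t₁ u × Consec (closed vs) s₂ t₂ × GSEdge G S s₂ t₂ u ×
      ¬ SameEdge s₂ t₂ s₁ t₁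
  cycle-has-two-labelled-edges {v ∷ vs} uniq 3≤len lab {u} {p} {q} p∈ q∈ (Su , p≁q) =
    let (s₁ , t₁ , c₁ , g₁) = first-edge
        (s₂ , t₂ , c₂ , g₂ , ≢₂₁) = cycle-has-second-labelled-edge 3≤len lab (open-at uniq c₁) g₁
    in  s₁ , t₁ , s₂ , t₂ , c₁ , g₁ , c₂ , g₂ , ≢₂₁
    where
    from-v : ∀ {z} → z ∈ v ∷ vs → adj G v u ≢ adj G z u →
             ∃₂ λ s t → Consec (closed (v ∷ vs)) s t × GSEdge G S s t u
    from-v z∈ v≁z =
      let (s , t , c , g) = walk-crosses-label (λ c → lab (consec-++⁺ˡ c)) (reach-along z∈) (Su , v≁z)
      in  s , t , consec-++⁺ˡ c , g
    first-edge : ∃₂ λ s t → Consec (closed (v ∷ vs)) s t × GSEdge G S s t u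
    first-edge with adj G v u Bool.≟ adj G p u
    ... | yes v~p = from-v q∈ λ v~q → p≁q (trans (≡-sym v~p) v~q)
    ... | no v≁p  = from-v p∈ v≁p

module Cycles {n} (G : Graph n) (S S′ : Subset n) (F : Fin n → Fin n → Set)
  (distinguishing : Distinguishing G S)
  (F-labelled : ∀ x y → F x y → ∃ λ u → S′ u ≡ true × GSEdge G S x y u)
  (F-two : ∀ u → S′ u ≡ true →
      ∃ λ a → ∃ λ b → ∃ λ c → ∃ λ d →
        F a b × F c d × GSEdge G S a b u × GSEdge G S c d u ×
        ¬ SameEdge a b c d ×
        (∀ x y → F x y → GSEdge G S x y u → SameEdge x y a b ⊎ SameEdge x y c d)) where

  open DecMembership (_≟_ {n}) using (_∈?_)

  F-in-GS : InGS G S F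
  F-in-GS {a} {b} f = let (u , _ , g) = F-labelled a b f in u , g

  -- The ear and both arcs of the cycle between its ends each carry an edge labelled u.
  no-ear : ∀ {V vs} → IsCycle V F vs → ¬ Ear (_∈ vs) F (CycEdge vs)
  no-ear {vs = vs} (len , uniq , _ , inF) (p , q , p∈ , q∈ , p≢q , walk)
    with walk-ends-outside G S (λ e → F-in-GS (proj₁ e)) walk
  ... | inj₁ p≡q = p≢q p≡q
  ... | inj₂ (Sp , Sq)
    with distinguishing-separates G S distinguishing Sp Sq p≢q
  ... | u , sep
    with walk-crosses-label G S (λ e → F-in-GS (proj₁ e)) walk sep
       | cycle-has-two-labelled-edges G S uniq len (λ c → F-in-GS (inF _ _ c)) p∈ q∈ sep
  ... | s , t , (Fst , st∉C) , g | s₁ , t₁ , s₂ , t₂ , c₁ , g₁ , c₂ , g₂ , ≢₂₁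
    with F-labelled s t Fst
  ... | u′ , S′u′ , g′
    with F-two u (subst (λ w → S′ w ≡ true) (≡-sym (gsEdge-label-unique G S g g′)) S′u′)
  ... | _ , _ , _ , _ , _ , _ , _ , _ , _ , only =
    three-edges-among-two
      (λ same → st∉C (cycEdge-resp vs same (inj₁ c₁)))
      (λ same → st∉C (cycEdge-resp vs same (inj₁ c₂)))
      (λ same → ≢₂₁ (sameEdge-sym same))
      (only s t Fst g) (only s₁ t₁ (inF _ _ c₁) g₁) (only s₂ t₂ (inF _ _ c₂) g₂)

  shared-consec⇒cycEdge⊆ : ∀ {V c₁ c₂} → IsCycle V F c₁ → IsCycle V F c₂ →
                           ∀ {a b} → Consec (closed c₁) a b → CycEdge c₂ a b →
                           ∀ {x y} → CycEdge c₁ x y → CycEdge c₂ x y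
  shared-consec⇒cycEdge⊆ {c₁ = c₁} {c₂} (_ , uniq₁ , _ , inF₁) cyc₂ {b = b} ab ab∈c₂ {x} {y} xy
    with cycEdge? c₂ x y
  ... | yes xy∈c₂ = xy∈c₂
  ... | no xy∉c₂  = ⊥-elim (avoid xy)
    where
    open Opening (open-at uniq₁ ab)
    through : ∀ {s t} → Consec (closed c₁) s t → ¬ CycEdge c₂ s t → ⊥
    through st st∉c₂ with complete st
    ... | inj₂ (refl , refl) = st∉c₂ ab∈c₂
    ... | inj₁ st′ = no-ear cyc₂
      (path-leaving-E-has-ear (_∈ c₂) (_∈? c₂) F (CycEdge c₂) (cycEdge? c₂) (cycEdge-∈ c₂)
         b path unique ends (proj₂ (cycEdge-∈ c₂ ab∈c₂)) (proj₁ (cycEdge-∈ c₂ ab∈c₂))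
         (λ c → inF₁ _ _ (sound c)) st′ st∉c₂)
    avoid : CycEdge c₁ x y → ⊥
    avoid (inj₁ xy) = through xy xy∉c₂
    avoid (inj₂ yx) = through yx λ yx∈c₂ → xy∉c₂ (cycEdge-swap c₂ yx∈c₂)

  shared-edge⇒cycEdge⊆ : ∀ {V c₁ c₂} → IsCycle V F c₁ → IsCycle V F c₂ →
                         ∀ {a b} → CycEdge c₁ a b → CycEdge c₂ a b →
                         ∀ {x y} → CycEdge c₁ x y → CycEdge c₂ x y
  shared-edge⇒cycEdge⊆ cyc₁ cyc₂ (inj₁ ab) ab∈c₂ = shared-consec⇒cycEdge⊆ cyc₁ cyc₂ ab ab∈c₂
  shared-edge⇒cycEdge⊆ {c₂ = c₂} cyc₁ cyc₂ (inj₂ ba) ab∈c₂ =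
    shared-consec⇒cycEdge⊆ cyc₁ cyc₂ ba (cycEdge-swap c₂ ab∈c₂)

  shared-edge⇒sameCycle : ∀ {V c₁ c₂} → IsCycle V F c₁ → IsCycle V F c₂ →
                          ∀ {a b} → CycEdge c₁ a b → CycEdge c₂ a b → SameCycle c₁ c₂
  shared-edge⇒sameCycle cyc₁ cyc₂ ab₁ ab₂ x y =
    mk⇔ (shared-edge⇒cycEdge⊆ cyc₁ cyc₂ ab₁ ab₂) (shared-edge⇒cycEdge⊆ cyc₂ cyc₁ ab₂ ab₁)

reach-within-component : ∀ {n} {F : Fin n → Fin n → Set} {v₀ x y} →
                         Reach F v₀ x → Reach F x y → Reach (CompE F v₀) x y
reach-within-component v₀x stay       = stay
reach-within-component v₀x (step e r) = step (e , v₀x) (reach-within-component (reach-∷ʳ v₀x e) r)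

lemma9 : ∀ {n} (G : Graph n) (S S′ : Subset n) (F : Fin n → Fin n → Set) →
    Distinguishing G S →
    S′ ⊆ S →
    (∃ λ u → S′ u ≡ true) →
    (∀ x y → F x y → F y x) →
    (∀ x y → F x y → ∃ λ u → S′ u ≡ true × GSEdge G S x y u) →
    (∀ u → S′ u ≡ true →
      ∃ λ a → ∃ λ b → ∃ λ c → ∃ λ d →
        F a b × F c d × GSEdge G S a b u × GSEdge G S c d u ×
        ¬ SameEdge a b c d ×
        (∀ x y → F x y → GSEdge G S x y u → SameEdge x y a b ⊎ SameEdge x y c d)) →
    ∀ v₀ → VH F v₀ → Cactus (CompV F v₀) (CompE F v₀)
lemma9 G S S′ F distinguishing _ _ F-sym F-labelled F-two v₀ _ = connected , cycles
  where
  open Cycles G S S′ F distinguishing F-labelled F-two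
  connected : ∀ x y → CompV F v₀ x → CompV F v₀ y → Reach (CompE F v₀) x y
  connected x y (_ , v₀x) (_ , v₀y) =
    reach-within-component v₀x (reach-++ (reach-reverse (F-sym _ _) v₀x) v₀y)
  cycles : ∀ c₁ c₂ → IsCycle (CompV F v₀) (CompE F v₀) c₁ → IsCycle (CompV F v₀) (CompE F v₀) c₂ →
           ∀ a b → CycEdge c₁ a b → CycEdge c₂ a b → SameCycle c₁ c₂
  cycles c₁ c₂ cyc₁ cyc₂ a b =
    shared-edge⇒sameCycle (isCycle-map proj₁ cyc₁) (isCycle-map proj₁ cyc₂)
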